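{- If $I = (I_1,I_2,I_3) \in \{0,1\}^3$ satisfies $I_1 = 0$ and $I_2 = I_3$, then $L(n,I) \geq 2^{n-3} - 2$ for every $n \in \mathbb{N}$.
   Context: For $n \in \mathbb{N}$ and $I=(I_1,I_2,I_3) \in \{0,1\}^3$, $M_I^{(n)}$ is the tournament on $\{x_1,\ldots,x_{2n}\} \cup \{y_1,\ldots,y_n\}$ with: (i) $x_i \to x_j$ for $i<j$; (ii) $x_{2i} \to y_i \to x_{2i-1}$ for each $i \in [n]$; (iii) for $i<j$, $y_i \to y_j$ iff $I_1=1$; (iv) for $i \le 2j-2$, $x_i \to y_j$ iff $I_2 = 1$; (v) for $i \ge 2j+1$, $y_j \to x_i$ iff $I_3 = 1$. $L(n,I)$ is the number of pairwise non-isomorphic $n$-vertex tournaments that are isomorphic to an induced sub-tournament of $M_I^{(m)}$ for some (equivalently all sufficiently large) $m$. -}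

module Defs where

open import Data.Bool using (Bool; true; false; not; if_then_else_)
open import Data.Nat using (ℕ; _*_; _∸_; _≤_; _<ᵇ_; _≡ᵇ_)
open import Data.Fin using (Fin)
open import Data.Product using (Σ; _×_; ∃-syntax)
open import Function.Bundles using (_↔_; Inverse)
open import Function.Definitions using (Injective)
import Data.Empty
open import Relation.Binary.PropositionalEquality using (_≡_; _≢_)

record Tournament (n : ℕ) : Set where
  field
    adj    : Fin n → Fin n → Bool
    irrefl : ∀ i → adj i i ≡ false
    tourn  : ∀ i j → i ≢ j → adj i j ≡ not (adj j i)
open Tournament public

Iso : {n : ℕ} → Tournament n → Tournament n → Set
Iso {n} T S = Σ (Fin n ↔ Fin n) λ σ →
  ∀ i j → adj S (Inverse.to σ i) (Inverse.to σ j) ≡ adj T i j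

-- Vertices x_i and y_j (1-indexed, as in the paper).
data V : Set where
  x : ℕ → V
  y : ℕ → V

InM : ℕ → V → Set
InM m (x i) = (1 ≤ i) × (i ≤ 2 * m)
InM m (y j) = (1 ≤ j) × (j ≤ m)

-- Does x_i → y_j hold in M_I (for 1 ≤ j)?
--   i = 2j : yes (ii);  i = 2j-1 : no (ii);
--   i ≤ 2j-2 : iff I2 = 1 (iv);  i ≥ 2j+1 : iff I3 = 0 (v).
xToY : Bool → Bool → ℕ → ℕ → Bool
xToY I2 I3 i j =
  if i ≡ᵇ 2 * j then true
  else if i ≡ᵇ 2 * j ∸ 1 then false
  else if i <ᵇ 2 * j ∸ 1 then I2
  else not I3

-- Arc relation of M_I^(m) (it does not depend on m), I = (I1, I2, I3).
arcM : Bool → Bool → Bool → V → V → Bool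
arcM I1 I2 I3 (x i) (x j) = i <ᵇ j
arcM I1 I2 I3 (x i) (y j) = xToY I2 I3 i j
arcM I1 I2 I3 (y j) (x i) = not (xToY I2 I3 i j)
arcM I1 I2 I3 (y i) (y j) =
  if i <ᵇ j then I1 else (if j <ᵇ i then not I1 else false)

EmbedsInM : Bool → Bool → Bool → ℕ → {n : ℕ} → Tournament n → Set
EmbedsInM I1 I2 I3 m {n} T = Σ (Fin n → V) λ f →
  (∀ i → InM m (f i)) × Injective _≡_ _≡_ f ×
  (∀ i j → arcM I1 I2 I3 (f i) (f j) ≡ adj T i j)

InClass : Bool → Bool → Bool → {n : ℕ} → Tournament n → Set
InClass I1 I2 I3 T = ∃[ m ] EmbedsInM I1 I2 I3 m T

-- "L(n,I) ≥ k": there are k pairwise non-isomorphic n-vertex tournaments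
-- each isomorphic to an induced sub-tournament of some M_I^(m).
LAtLeast : Bool → Bool → Bool → ℕ → ℕ → Set
LAtLeast I1 I2 I3 n k = Σ (Fin k → Tournament n) λ Ts →
  (∀ a → InClass I1 I2 I3 (Ts a)) ×
  (∀ a b → a ≢ b → ¬Iso (Ts a) (Ts b))
  where
  ¬Iso : Tournament n → Tournament n → Set
  ¬Iso T S = Iso T S → Data.Empty.⊥

module Submission where

-- For a word w over {0,1}, place the letters at positions 0,1,2,… and let
-- a letter 1 at position p become x_{2p+2} and a letter 0 become y_{p+1}.
-- For I = (0,0,0) the induced tournament has: earlier 1s beat later 1s, and
-- every other pair is won by the later position; for I = (0,1,1) one obtains
-- the converse of this tournament for the complementary word.  When w starts
-- with 100, a letter 0 at position p has score p, and the positions of the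
-- letters 0 are recovered isomorphism-invariantly as the scores of the vertices
-- beating the unique out-neighbour of a score-1 vertex.  Hence the 2^(n-3)
-- words 100v give pairwise non-isomorphic tournaments in the class.

open import Defs
open import Data.Bool using (Bool; true; false; not; if_then_else_; _∧_; T)
open import Data.Bool.Properties using (not-involutive)
open import Data.Nat using (ℕ; zero; suc; _+_; _∸_; _^_; _≤_; _<ᵇ_; _≡ᵇ_; z≤n; s≤s)
open import Data.Nat.Properties
  using (+-suc; +-identityʳ; suc-injective; +-mono-≤; ≤-trans; m≤m+n; m≤n+m; m∸n≤m; <⇒≤; ≡⇒≡ᵇ; +-0-commutativeMonoid)
  renaming (_≟_ to _≟ℕ_)
open import Data.Fin using (Fin; zero; suc; toℕ; inject≤; finToFun; funToFin; combine)
open import Data.Fin.Properties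
  using (toℕ-injective; toℕ<n; _≟_; inject≤-injective; funToFin-finToFin; 2↔Bool)
open import Data.Vec.Functional using (_∷_)
open import Data.Product using (_,_)
open import Data.Sum using (_⊎_; inj₁; inj₂)
open import Data.Empty using (⊥; ⊥-elim)
open import Function using (_∘_)
open import Function.Bundles using (Inverse; Injection)
open import Function.Definitions using (Injective)
open import Function.Properties.Inverse using (↔-sym; ↔⇒↣)
open import Relation.Nullary using (yes; no)
open import Relation.Binary.PropositionalEquality
open import Algebra.Properties.CommutativeMonoid.Sum +-0-commutativeMonoid
  using (sum; sum-permute; sum-cong-≗)

<ᵇ-irrefl : ∀ m → (m <ᵇ m) ≡ false
<ᵇ-irrefl zero    = refl
<ᵇ-irrefl (suc m) = <ᵇ-irrefl m

data Ordered (m n : ℕ) : Set where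
  less    : (m <ᵇ n) ≡ true  → (n <ᵇ m) ≡ false → Ordered m n
  greater : (m <ᵇ n) ≡ false → (n <ᵇ m) ≡ true  → Ordered m n

compare-≢ : ∀ m n → m ≢ n → Ordered m n
compare-≢ zero    zero    m≢n = ⊥-elim (m≢n refl)
compare-≢ zero    (suc n) _   = less refl refl
compare-≢ (suc m) zero    _   = greater refl refl
compare-≢ (suc m) (suc n) m≢n with compare-≢ m n (m≢n ∘ cong suc)
... | less    m<n n≮m = less m<n n≮m
... | greater m≮n n<m = greater m≮n n<m

double-<ᵇ : ∀ m n → (m + m <ᵇ n + n) ≡ (m <ᵇ n)
double-<ᵇ zero    zero    = refl
double-<ᵇ zero    (suc n) = refl
double-<ᵇ (suc m) zero    = refl
double-<ᵇ (suc m) (suc n) rewrite +-suc m m | +-suc n n = double-<ᵇ m n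

odd-<ᵇ-double : ∀ m n → (suc (m + m) <ᵇ n + n) ≡ (m <ᵇ n)
odd-<ᵇ-double zero    zero    = refl
odd-<ᵇ-double zero    (suc n) rewrite +-suc n n = refl
odd-<ᵇ-double (suc m) zero    = refl
odd-<ᵇ-double (suc m) (suc n) rewrite +-suc m m | +-suc n n = odd-<ᵇ-double m n

double-≡ᵇ : ∀ m n → m ≢ n → (m + m ≡ᵇ n + n) ≡ false
double-≡ᵇ zero    zero    m≢n = ⊥-elim (m≢n refl)
double-≡ᵇ zero    (suc n) _   = refl
double-≡ᵇ (suc m) zero    _   = refl
double-≡ᵇ (suc m) (suc n) m≢n rewrite +-suc m m | +-suc n n = double-≡ᵇ m n (m≢n ∘ cong suc)

odd-≡ᵇ-double : ∀ m n → (suc (m + m) ≡ᵇ n + n) ≡ false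
odd-≡ᵇ-double zero    zero    = refl
odd-≡ᵇ-double zero    (suc n) rewrite +-suc n n = refl
odd-≡ᵇ-double (suc m) zero    = refl
odd-≡ᵇ-double (suc m) (suc n) rewrite +-suc m m | +-suc n n = odd-≡ᵇ-double m n

double-injective : ∀ m n → m + m ≡ n + n → m ≡ n
double-injective m n m+m≡n+n with m ≟ℕ n
... | yes m≡n = m≡n
... | no  m≢n = ⊥-elim (subst T (double-≡ᵇ m n m≢n) (≡⇒≡ᵇ _ _ m+m≡n+n))

false⇔false⇒≡ : ∀ {a b} → (a ≡ false → b ≡ false) → (b ≡ false → a ≡ false) → a ≡ b
false⇔false⇒≡ {false} {false} _ _ = refl
false⇔false⇒≡ {true}  {true}  _ _ = refl
false⇔false⇒≡ {false} {true}  a⇒b _ = sym (a⇒b refl)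
false⇔false⇒≡ {true}  {false} _ b⇒a = b⇒a refl

funToFin-cong : ∀ {m n} {f g : Fin m → Fin n} → (∀ i → f i ≡ g i) → funToFin f ≡ funToFin g
funToFin-cong {zero}  _   = refl
funToFin-cong {suc m} f≗g = cong₂ combine (f≗g zero) (funToFin-cong (f≗g ∘ suc))

finToFun-injective : ∀ {m n} {k l : Fin (n ^ m)} → (∀ i → finToFun {n} {m} k i ≡ finToFun l i) → k ≡ l
finToFun-injective {m} {n} {k} {l} k≗l = begin
  k                         ≡⟨ funToFin-finToFin {m} {n} k ⟨
  funToFin {m} (finToFun k) ≡⟨ funToFin-cong k≗l ⟩
  funToFin {m} (finToFun l) ≡⟨ funToFin-finToFin {m} {n} l ⟩
  l                         ∎
  where open ≡-Reasoning

-- `2 * suc n` normalises to `suc (n + suc (n + 0))`; rewriting with this lemma turns it into `suc (suc (n + n))` inside `xToY`.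
2*suc : ∀ n → n + suc (n + 0) ≡ suc (n + n)
2*suc n rewrite +-identityʳ n = +-suc n n

arcM-irrefl : ∀ I1 I2 I3 u → arcM I1 I2 I3 u u ≡ false
arcM-irrefl I1 I2 I3 (x i) = <ᵇ-irrefl i
arcM-irrefl I1 I2 I3 (y j) rewrite <ᵇ-irrefl j = refl

arcM-antisym : ∀ I1 I2 I3 u v → u ≢ v → arcM I1 I2 I3 u v ≡ not (arcM I1 I2 I3 v u)
arcM-antisym I1 I2 I3 (x i) (x j) u≢v with compare-≢ i j (u≢v ∘ cong x)
... | less    i<j j≮i rewrite i<j | j≮i = refl
... | greater i≮j j<i rewrite i≮j | j<i = refl
arcM-antisym I1 I2 I3 (x i) (y j) _ = sym (not-involutive _)
arcM-antisym I1 I2 I3 (y j) (x i) _ = refl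
arcM-antisym I1 I2 I3 (y i) (y j) u≢v with compare-≢ i j (u≢v ∘ cong y)
... | less    i<j j≮i rewrite i<j | j≮i = sym (not-involutive _)
... | greater i≮j j<i rewrite i≮j | j<i = refl

induced : ∀ I1 I2 I3 {n} (f : Fin n → V) → Injective _≡_ _≡_ f → Tournament n
induced I1 I2 I3 f f-injective = record
  { adj    = λ i j → arcM I1 I2 I3 (f i) (f j)
  ; irrefl = λ i → arcM-irrefl I1 I2 I3 (f i)
  ; tourn  = λ i j i≢j → arcM-antisym I1 I2 I3 (f i) (f j) (i≢j ∘ f-injective)
  }

induced-inClass : ∀ {I1 I2 I3 n} m (f : Fin n → V) (f-injective : Injective _≡_ _≡_ f) →
  (∀ i → InM m (f i)) → InClass I1 I2 I3 (induced I1 I2 I3 f f-injective)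
induced-inClass m f f-injective f∈M = m , f , f∈M , f-injective , λ _ _ → refl

converse : ∀ {n} → Tournament n → Tournament n
converse T = record
  { adj    = λ i j → adj T j i
  ; irrefl = irrefl T
  ; tourn  = λ i j i≢j → tourn T j i (i≢j ∘ sym)
  }

converse-iso : ∀ {n} {T S : Tournament n} → Iso T S → Iso (converse T) (converse S)
converse-iso (σ , σ-adj) = σ , λ i j → σ-adj j i

iso-sym : ∀ {n} {T S : Tournament n} → Iso T S → Iso S T
iso-sym {T = T} {S} (σ , σ-adj) = ↔-sym σ , λ i j → begin
  adj T (from i) (from j)          ≡⟨ σ-adj (from i) (from j) ⟨
  adj S (to (from i)) (to (from j)) ≡⟨ cong₂ (adj S) (strictlyInverseˡ i) (strictlyInverseˡ j) ⟩
  adj S i j                        ∎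
  where open Inverse σ
        open ≡-Reasoning

boolToℕ : Bool → ℕ
boolToℕ false = 0
boolToℕ true  = 1

score : ∀ {n} → Tournament n → Fin n → ℕ
score T i = sum (λ j → boolToℕ (adj T i j))

score-iso : ∀ {n} {T S : Tournament n} ((σ , _) : Iso T S) → ∀ i → score S (Inverse.to σ i) ≡ score T i
score-iso {S = S} (σ , σ-adj) i =
  trans (sum-permute (λ j → boolToℕ (adj S (Inverse.to σ i) j)) σ)
        (sum-cong-≗ (cong boolToℕ ∘ σ-adj i))

lookup≤sum : ∀ {n} (g : Fin n → ℕ) i → g i ≤ sum g
lookup≤sum g zero    = m≤m+n (g zero) _
lookup≤sum g (suc i) = ≤-trans (lookup≤sum (g ∘ suc) i) (m≤n+m _ (g zero))

two-ones≤sum : ∀ {n} (g : Fin n → ℕ) i j → i ≢ j → g i ≡ 1 → g j ≡ 1 → 2 ≤ sum g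
two-ones≤sum g zero    zero    i≢j _   _   = ⊥-elim (i≢j refl)
two-ones≤sum g zero    (suc j) _   gi≡1 gj≡1 rewrite gi≡1 =
  s≤s (subst (_≤ sum (g ∘ suc)) gj≡1 (lookup≤sum (g ∘ suc) j))
two-ones≤sum g (suc i) zero    _   gi≡1 gj≡1 rewrite gj≡1 =
  s≤s (subst (_≤ sum (g ∘ suc)) gi≡1 (lookup≤sum (g ∘ suc) i))
two-ones≤sum g (suc i) (suc j) i≢j gi≡1 gj≡1 =
  ≤-trans (two-ones≤sum (g ∘ suc) i j (i≢j ∘ cong suc) gi≡1 gj≡1) (m≤n+m _ (g zero))

score-one-unique : ∀ {n} (T : Tournament n) {i j k} → score T i ≡ 1 →
  adj T i j ≡ true → adj T i k ≡ true → j ≡ k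
score-one-unique T {i} {j} {k} score≡1 i→j i→k with j ≟ k
... | yes j≡k = j≡k
... | no  j≢k with subst (2 ≤_) score≡1
                  (two-ones≤sum _ j k j≢k (cong boolToℕ i→j) (cong boolToℕ i→k))
...   | s≤s ()

count-below : ∀ n k → k ≤ n → sum {n} (λ j → boolToℕ (toℕ j <ᵇ k)) ≡ k
count-below zero    zero    _       = refl
count-below (suc n) zero    _       = count-below n zero z≤n
count-below (suc n) (suc k) (s≤s k≤n) = cong suc (count-below n k k≤n)

wordArc : Bool → Bool → ℕ → ℕ → Bool
wordArc a b p q = if a ∧ b then p <ᵇ q else q <ᵇ p

record Realises {n} (T : Tournament n) (w : Fin n → Bool) : Set where
  constructor realisesWith
  field
    arc : ∀ p q → p ≢ q → adj T p q ≡ wordArc (w p) (w q) (toℕ p) (toℕ q)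

module _ {n} {T : Tournament n} {w : Fin n → Bool} (realises : Realises T w) where

  open Realises realises

  adj-from-letter0 : ∀ p → w p ≡ false → ∀ q → adj T p q ≡ (toℕ q <ᵇ toℕ p)
  adj-from-letter0 p wp≡0 q with q ≟ p
  ... | yes refl rewrite irrefl T p | <ᵇ-irrefl (toℕ p) = refl
  ... | no  q≢p  rewrite arc p q (q≢p ∘ sym) | wp≡0 = refl

  adj-letter1-to-letter0 : ∀ p q → w p ≡ true → w q ≡ false → adj T p q ≡ (toℕ q <ᵇ toℕ p)
  adj-letter1-to-letter0 p q wp≡1 wq≡0 =
    trans (arc p q p≢q) (cong₂ (λ a b → wordArc a b (toℕ p) (toℕ q)) wp≡1 wq≡0)
    where
    p≢q : p ≢ q
    p≢q refl with trans (sym wp≡1) wq≡0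
    ... | ()

  adj-letter1-to-letter1 : ∀ p q → w p ≡ true → w q ≡ true → adj T p q ≡ (toℕ p <ᵇ toℕ q)
  adj-letter1-to-letter1 p q wp≡1 wq≡1 with p ≟ q
  ... | yes refl rewrite irrefl T p | <ᵇ-irrefl (toℕ p) = refl
  ... | no  p≢q  rewrite arc p q p≢q | wp≡1 | wq≡1 = refl

  score-of-letter0 : ∀ p → w p ≡ false → score T p ≡ toℕ p
  score-of-letter0 p wp≡0 =
    trans (sum-cong-≗ (cong boolToℕ ∘ adj-from-letter0 p wp≡0))
          (count-below n (toℕ p) (<⇒≤ (toℕ<n p)))

wordVertex : Bool → ℕ → V
wordVertex true  p = x (suc (suc (p + p)))
wordVertex false p = y (suc p)

xToY-wordVertex : ∀ b p q → p ≢ q →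
  xToY b b (suc (suc (p + p))) (suc q) ≡ (if p <ᵇ q then b else not b)
xToY-wordVertex b p q p≢q
  rewrite 2*suc q | double-≡ᵇ p q p≢q | odd-≡ᵇ-double p q | odd-<ᵇ-double p q = refl

arcM₀₀₀-wordVertex : ∀ a b p q → p ≢ q →
  arcM false false false (wordVertex a p) (wordVertex b q) ≡ wordArc a b p q
arcM₀₀₀-wordVertex true  true  p q _ = double-<ᵇ p q
arcM₀₀₀-wordVertex true  false p q p≢q rewrite xToY-wordVertex false p q p≢q
  with compare-≢ p q p≢q
... | less    p<q q≮p rewrite p<q | q≮p = refl
... | greater p≮q q<p rewrite p≮q | q<p = refl
arcM₀₀₀-wordVertex false true  p q p≢q rewrite xToY-wordVertex false q p (p≢q ∘ sym)
  with q <ᵇ p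
... | false = refl
... | true  = refl
arcM₀₀₀-wordVertex false false p q p≢q with compare-≢ p q p≢q
... | less    p<q q≮p rewrite p<q | q≮p = refl
... | greater p≮q q<p rewrite p≮q | q<p = refl

arcM₀₁₁-wordVertex : ∀ a b p q → p ≢ q →
  arcM false true true (wordVertex (not b) q) (wordVertex (not a) p) ≡ wordArc a b p q
arcM₀₁₁-wordVertex true  true  p q p≢q with compare-≢ p q p≢q
... | less    p<q q≮p rewrite p<q | q≮p = refl
... | greater p≮q q<p rewrite p≮q | q<p = refl
arcM₀₁₁-wordVertex true  false p q p≢q rewrite xToY-wordVertex true q p (p≢q ∘ sym)
  with q <ᵇ p
... | false = refl
... | true  = refl
arcM₀₁₁-wordVertex false true  p q p≢q rewrite xToY-wordVertex true p q p≢q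
  with compare-≢ p q p≢q
... | less    p<q q≮p rewrite p<q | q≮p = refl
... | greater p≮q q<p rewrite p≮q | q<p = refl
arcM₀₁₁-wordVertex false false p q _ = double-<ᵇ q p

wordEmbedding : ∀ {n} → (Fin n → Bool) → Fin n → V
wordEmbedding w p = wordVertex (w p) (toℕ p)

wordEmbedding-injective : ∀ {n} (w : Fin n → Bool) → Injective _≡_ _≡_ (wordEmbedding w)
wordEmbedding-injective w {p} {q} fp≡fq with w p | w q | fp≡fq
... | true  | true  | e = toℕ-injective (double-injective _ _ (suc-injective (suc-injective (x-injective e))))
  where x-injective : ∀ {i j} → x i ≡ x j → i ≡ j
        x-injective refl = refl
... | false | false | e = toℕ-injective (suc-injective (y-injective e))
  where y-injective : ∀ {i j} → y i ≡ y j → i ≡ j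
        y-injective refl = refl

wordEmbedding-InM : ∀ {n} (w : Fin n → Bool) p → InM n (wordEmbedding w p)
wordEmbedding-InM {n} w p with w p
... | true  = s≤s z≤n , 2p+2≤2n
  where
  2p+2≤2n : suc (suc (toℕ p + toℕ p)) ≤ n + (n + 0)
  2p+2≤2n rewrite +-identityʳ n | sym (+-suc (toℕ p) (toℕ p)) = +-mono-≤ (toℕ<n p) (toℕ<n p)
... | false = s≤s z≤n , toℕ<n p

wordTournament : ∀ {n} → Bool → (Fin n → Bool) → Tournament n
wordTournament false w = induced false false false (wordEmbedding w) (wordEmbedding-injective w)
wordTournament true  w = induced false true true (wordEmbedding (not ∘ w)) (wordEmbedding-injective (not ∘ w))

wordTournament-inClass : ∀ {n} b (w : Fin n → Bool) → InClass false b b (wordTournament b w)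
wordTournament-inClass {n} false w =
  induced-inClass n (wordEmbedding w) (wordEmbedding-injective w) (wordEmbedding-InM w)
wordTournament-inClass {n} true  w =
  induced-inClass n (wordEmbedding (not ∘ w)) (wordEmbedding-injective (not ∘ w)) (wordEmbedding-InM (not ∘ w))

realises-wordTournament₀₀₀ : ∀ {n} (w : Fin n → Bool) → Realises (wordTournament false w) w
realises-wordTournament₀₀₀ w = realisesWith λ p q p≢q →
  arcM₀₀₀-wordVertex (w p) (w q) (toℕ p) (toℕ q) (p≢q ∘ toℕ-injective)

realises-converse-wordTournament₀₁₁ : ∀ {n} (w : Fin n → Bool) → Realises (converse (wordTournament true w)) w
realises-converse-wordTournament₀₁₁ w = realisesWith λ p q p≢q →
  arcM₀₁₁-wordVertex (w p) (w q) (toℕ p) (toℕ q) (p≢q ∘ toℕ-injective)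

record RivalScore {n} (T : Tournament n) (k : ℕ) : Set where
  constructor rivalScore
  field
    target source rival : Fin n
    source-score        : score T source ≡ 1
    source-beats-target : adj T source target ≡ true
    rival-beats-target  : adj T rival target ≡ true
    rival-score         : score T rival ≡ k

rivalScore-transport : ∀ {n} {T S : Tournament n} {k} → Iso T S → RivalScore T k → RivalScore S k
rivalScore-transport {T = T} {S} iso@(σ , σ-adj) (rivalScore a b z b-score b→a z→a z-score) =
  rivalScore (to a) (to b) (to z)
    (trans (score-iso {T = T} {S} iso b) b-score) (trans (σ-adj b a) b→a)
    (trans (σ-adj z a) z→a)                   (trans (score-iso {T = T} {S} iso z) z-score)
  where open Inverse σ

module _ {m} {v : Fin m → Bool} {T : Tournament (3 + m)}
         (realises : Realises T (true ∷ false ∷ false ∷ v)) where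

  private
    w : Fin (3 + m) → Bool
    w = true ∷ false ∷ false ∷ v

  rivalScore-of-letter0 : ∀ p → w p ≡ false → RivalScore T (toℕ p)
  rivalScore-of-letter0 (suc p) wp≡0 = rivalScore zero (suc zero) (suc p)
    (score-of-letter0 realises (suc zero) refl)
    (adj-from-letter0 realises (suc zero) refl zero)
    (adj-from-letter0 realises (suc p) wp≡0 zero)
    (score-of-letter0 realises (suc p) wp≡0)

  score-one-positions : ∀ p → score T p ≡ 1 → p ≡ zero ⊎ p ≡ suc zero
  score-one-positions zero                   _ = inj₁ refl
  score-one-positions (suc zero)             _ = inj₂ refl
  score-one-positions (suc (suc zero)) score≡1
    with trans (sym (score-of-letter0 realises (suc (suc zero)) refl)) score≡1
  ... | ()
  score-one-positions p@(suc (suc (suc i))) score≡1 with v i in vi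
  ... | false with trans (sym (score-of-letter0 realises p vi)) score≡1
  ...   | ()
  score-one-positions p@(suc (suc (suc i))) score≡1 | true
    with score-one-unique T score≡1 (adj-letter1-to-letter0 realises p (suc zero) vi refl)
                                    (adj-letter1-to-letter0 realises p (suc (suc zero)) vi refl)
  ... | ()

  second-beats-only-first : ∀ a → adj T (suc zero) a ≡ true → a ≡ zero
  second-beats-only-first zero    _   = refl
  second-beats-only-first (suc a) 1→a
    with trans (sym 1→a) (adj-from-letter0 realises (suc zero) refl (suc a))
  ... | ()

  rival-of-first-is-first : ∀ {a z} → score T zero ≡ 1 → adj T zero a ≡ true →
    adj T z a ≡ true → w z ≡ true → z ≡ zero
  rival-of-first-is-first {z = zero}  _       _   _   _    = refl
  rival-of-first-is-first {z = suc z} score≡1 0→a z→a wz≡1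
    with score-one-unique T score≡1 (adj-letter1-to-letter1 realises zero (suc z) refl wz≡1) 0→a
  ... | refl with trans (sym z→a) (irrefl T (suc z))
  ...   | ()

  private
    letter0-at : ∀ {p} q → toℕ q ≡ toℕ p → w q ≡ false → w p ≡ false
    letter0-at q q≡p wq≡0 = subst (λ r → w r ≡ false) (toℕ-injective q≡p) wq≡0

  letter0-of-rivalScore : ∀ p → RivalScore T (toℕ p) → w p ≡ false
  letter0-of-rivalScore p (rivalScore a b z b-score b→a z→a z-score) with w z in wz
  ... | false = letter0-at z (trans (sym (score-of-letter0 realises z wz)) z-score) wz
  ... | true with score-one-positions b b-score
  ...   | inj₁ refl with rival-of-first-is-first b-score b→a z→a wz
  ...     | refl = letter0-at (suc zero) (trans (sym b-score) z-score) refl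
  letter0-of-rivalScore p (rivalScore a b z b-score b→a z→a z-score) | true | inj₂ refl
    with second-beats-only-first a b→a
  ... | refl with trans (sym z→a) (adj-letter1-to-letter1 realises z zero wz refl)
  ...   | ()

iso-preserves-prefixed-word : ∀ {m} {v v' : Fin m → Bool} {T S : Tournament (3 + m)} →
  Realises T (true ∷ false ∷ false ∷ v) → Realises S (true ∷ false ∷ false ∷ v') →
  Iso T S → ∀ i → v i ≡ v' i
iso-preserves-prefixed-word {T = T} {S} realisesT realisesS iso i = false⇔false⇒≡
  (λ vi≡0 → letter0-of-rivalScore realisesS p
              (rivalScore-transport {T = T} {S} iso (rivalScore-of-letter0 realisesT p vi≡0)))
  (λ v'i≡0 → letter0-of-rivalScore realisesT p
               (rivalScore-transport {T = S} {T} (iso-sym {T = T} {S} iso)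
                 (rivalScore-of-letter0 realisesS p v'i≡0)))
  where p = suc (suc (suc i))

wordTournament-iso⇒≗ : ∀ b {m} (v v' : Fin m → Bool) →
  Iso (wordTournament b (true ∷ false ∷ false ∷ v)) (wordTournament b (true ∷ false ∷ false ∷ v')) →
  ∀ i → v i ≡ v' i
wordTournament-iso⇒≗ false v v' iso = iso-preserves-prefixed-word
  (realises-wordTournament₀₀₀ (true ∷ false ∷ false ∷ v))
  (realises-wordTournament₀₀₀ (true ∷ false ∷ false ∷ v')) iso
wordTournament-iso⇒≗ true  v v' iso = iso-preserves-prefixed-word
  (realises-converse-wordTournament₀₁₁ (true ∷ false ∷ false ∷ v))
  (realises-converse-wordTournament₀₁₁ (true ∷ false ∷ false ∷ v'))
  (converse-iso {T = wordTournament true (true ∷ false ∷ false ∷ v)}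
                {S = wordTournament true (true ∷ false ∷ false ∷ v')} iso)

binaryWord : ∀ {m} → Fin (2 ^ m) → Fin m → Bool
binaryWord {m} k = Inverse.to 2↔Bool ∘ finToFun {2} {m} k

binaryWord-injective : ∀ {m} {k l : Fin (2 ^ m)} → (∀ i → binaryWord k i ≡ binaryWord l i) → k ≡ l
binaryWord-injective {m} k≗l = finToFun-injective {m} {2} (Injection.injective (↔⇒↣ 2↔Bool) ∘ k≗l)

lemma15 : (I1 I2 I3 : Bool) → I1 ≡ false → I2 ≡ I3 →
    (n : ℕ) → LAtLeast I1 I2 I3 n (2 ^ (n ∸ 3) ∸ 2)
lemma15 .false b .b refl refl zero                = (λ ()) , (λ ()) , (λ ())
lemma15 .false b .b refl refl (suc zero)          = (λ ()) , (λ ()) , (λ ())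
lemma15 .false b .b refl refl (suc (suc zero))    = (λ ()) , (λ ()) , (λ ())
lemma15 .false b .b refl refl (suc (suc (suc m))) =
  wordTournament b ∘ word , wordTournament-inClass b ∘ word , non-isomorphic
  where
  code : Fin (2 ^ m ∸ 2) → Fin (2 ^ m)
  code a = inject≤ a (m∸n≤m _ 2)
  word : Fin (2 ^ m ∸ 2) → Fin (3 + m) → Bool
  word a = true ∷ false ∷ false ∷ binaryWord (code a)
  non-isomorphic : ∀ a a' → a ≢ a' → Iso (wordTournament b (word a)) (wordTournament b (word a')) → ⊥
  non-isomorphic a a' a≢a' iso = a≢a' (inject≤-injective _ _ a a'
    (binaryWord-injective {m} (wordTournament-iso⇒≗ b (binaryWord (code a)) (binaryWord (code a')) iso)))
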